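{- In any BiKAT with projections $(\ddot{\mathbb A},\swarrow,\searrow)$ over a KAT $\mathbb A$, the following hold for all $a,b\in\mathbb A$: (Unit) $\swarrow 1 = 1 = \searrow 1$ (where the argument $1$ is the unit of $\ddot{\mathbb A}$ and the result the unit of $\mathbb A$); (Separation) if $\langle a] = [b\rangle$ and ($a\neq 0$ or $b\neq 0$), then $a=b=1$; (Order separation) if $\langle a]\ge [b\rangle$, $a\neq 0$ and $b\neq 0$, then $a\ge 1$ and $1\ge b$; (Injectivity) if $\langle a]=\langle b]$ then $a=b$, and if $[a\rangle=[b\rangle$ then $a=b$; (Order-injectivity) if $\langle a]\ge\langle b]$ then $a\ge b$, and if $[a\rangle\ge[b\rangle$ then $a\ge b$.
   Context: A KAT $(\mathbb A,\mathbb B,+,;,{}^*,\neg,1,0)$ is a Kleene algebra with a Boolean subalgebra $\mathbb B\subseteq\mathbb A$ of tests; $a\le b$ means $a+b=b$. A BiKAT over $\mathbb A$ is a KAT $\ddot{\mathbb A}$ together with KAT homomorphisms $\langle\cdot\,],[\,\cdot\rangle:\mathbb A\to\ddot{\mathbb A}$ (preserving $0,1,+,;,{}^*$, mapping tests to tests and preserving test negation) such that $\langle x];[y\rangle=[y\rangle;\langle x]$ for all $x,y\in\mathbb A$. A BiKAT with projections additionally has total functions $\swarrow,\searrow:\ddot{\mathbb A}\to\mathbb A$ such that for all $a\in\mathbb A$ and $A,B\in\ddot{\mathbb A}$: (Inversion) $\swarrow\langle a]=a$ and $\searrow[a\rangle=a$; (Disjointness) if $a\neq 0$ then $\swarrow[a\rangle=1$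 and $\searrow\langle a]=1$; (Disjunctivity) $\swarrow(A+B)=\swarrow A+\swarrow B$ and $\searrow(A+B)=\searrow A+\searrow B$. -}

module Defs where

open import Level using (Level; _⊔_; suc)
open import Relation.Binary.PropositionalEquality using (_≡_)
open import Relation.Nullary using (¬_)
open import Data.Product using (_×_)
open import Data.Sum using (_⊎_)

record KleeneAlgebra (ℓ : Level) : Set (suc ℓ) where
  infixl 6 _+_
  infixl 7 _︔_
  infix 4 _≤_
  field
    Carrier : Set ℓ
    _+_ : Carrier → Carrier → Carrier
    _︔_ : Carrier → Carrier → Carrier
    _⋆ : Carrier → Carrier
    𝟘 𝟙 : Carrier
  _≤_ : Carrier → Carrier → Set ℓ
  a ≤ b = a + b ≡ b
  field
    +-assoc : ∀ a b c → (a + b) + c ≡ a + (b + c)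
    +-comm  : ∀ a b → a + b ≡ b + a
    +-idem  : ∀ a → a + a ≡ a
    +-zero  : ∀ a → a + 𝟘 ≡ a
    ︔-assoc : ∀ a b c → (a ︔ b) ︔ c ≡ a ︔ (b ︔ c)
    ︔-identityˡ : ∀ a → 𝟙 ︔ a ≡ a
    ︔-identityʳ : ∀ a → a ︔ 𝟙 ≡ a
    ︔-zeroˡ : ∀ a → 𝟘 ︔ a ≡ 𝟘
    ︔-zeroʳ : ∀ a → a ︔ 𝟘 ≡ 𝟘
    distribˡ : ∀ a b c → a ︔ (b + c) ≡ a ︔ b + a ︔ c
    distribʳ : ∀ a b c → (a + b) ︔ c ≡ a ︔ c + b ︔ c
    ⋆-unfoldˡ : ∀ a → 𝟙 + a ︔ (a ⋆) ≤ a ⋆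
    ⋆-unfoldʳ : ∀ a → 𝟙 + (a ⋆) ︔ a ≤ a ⋆
    ⋆-inductˡ : ∀ a b c → b + a ︔ c ≤ c → (a ⋆) ︔ b ≤ c
    ⋆-inductʳ : ∀ a b c → b + c ︔ a ≤ c → b ︔ (a ⋆) ≤ c

record KAT (ℓ : Level) : Set (suc ℓ) where
  field
    KA : KleeneAlgebra ℓ
  open KleeneAlgebra KA public
  field
    Test : Set ℓ
    test : Test → Carrier
    test-injective : ∀ {p q} → test p ≡ test q → p ≡ q
    t𝟘 t𝟙 : Test
    _t+_ _t︔_ : Test → Test → Test
    t¬ : Test → Test
    test-𝟘 : test t𝟘 ≡ 𝟘
    test-𝟙 : test t𝟙 ≡ 𝟙
    test-+ : ∀ p q → test (p t+ q) ≡ test p + test q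
    test-︔ : ∀ p q → test (p t︔ q) ≡ test p ︔ test q
    -- Boolean algebra axioms for complement (the rest are inherited
    -- from the Kleene algebra via the injective embedding)
    ︔-comm-test : ∀ p q → test p ︔ test q ≡ test q ︔ test p
    ︔-idem-test : ∀ p → test p ︔ test p ≡ test p
    +-︔-distrib-test : ∀ p q r → test p + test q ︔ test r ≡ (test p + test q) ︔ (test p + test r)
    compl-+ : ∀ p → test p + test (t¬ p) ≡ 𝟙
    compl-︔ : ∀ p → test p ︔ test (t¬ p) ≡ 𝟘

record KATHom {ℓ₁ ℓ₂ : Level} (A : KAT ℓ₁) (B : KAT ℓ₂) : Set (ℓ₁ ⊔ ℓ₂) where
  private
    module A = KAT A
    module B = KAT B
  field
    ⟦_⟧ : A.Carrier → B.Carrier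
    ⟦_⟧ᵗ : A.Test → B.Test
    pres-test : ∀ p → ⟦ A.test p ⟧ ≡ B.test ⟦ p ⟧ᵗ
    pres-𝟘 : ⟦ A.𝟘 ⟧ ≡ B.𝟘
    pres-𝟙 : ⟦ A.𝟙 ⟧ ≡ B.𝟙
    pres-+ : ∀ a b → ⟦ a A.+ b ⟧ ≡ ⟦ a ⟧ B.+ ⟦ b ⟧
    pres-︔ : ∀ a b → ⟦ a A.︔ b ⟧ ≡ ⟦ a ⟧ B.︔ ⟦ b ⟧
    pres-⋆ : ∀ a → ⟦ a A.⋆ ⟧ ≡ ⟦ a ⟧ B.⋆
    pres-¬ : ∀ p → ⟦ A.t¬ p ⟧ᵗ ≡ B.t¬ ⟦ p ⟧ᵗ

record BiKAT {ℓ : Level} (A : KAT ℓ) (ℓ′ : Level) : Set (suc ℓ′ ⊔ ℓ) where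
  field
    Ä : KAT ℓ′
    L : KATHom A Ä
    R : KATHom A Ä
  private
    module A = KAT A
    module Ä = KAT Ä
  ⟨_] : A.Carrier → Ä.Carrier
  ⟨ a ] = KATHom.⟦_⟧ L a
  [_⟩ : A.Carrier → Ä.Carrier
  [ a ⟩ = KATHom.⟦_⟧ R a
  field
    interchange : ∀ x y → ⟨ x ] Ä.︔ [ y ⟩ ≡ [ y ⟩ Ä.︔ ⟨ x ]

record BiKATProj {ℓ : Level} (A : KAT ℓ) (ℓ′ : Level) : Set (suc ℓ′ ⊔ ℓ) where
  field
    bikat : BiKAT A ℓ′
  open BiKAT bikat public
  private
    module A = KAT A
    module Ä = KAT Ä
  field
    ↙ ↘ : Ä.Carrier → A.Carrier
    inversionˡ : ∀ a → ↙ ⟨ a ] ≡ a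
    inversionʳ : ∀ a → ↘ [ a ⟩ ≡ a
    disjointˡ : ∀ a → ¬ (a ≡ A.𝟘) → ↙ [ a ⟩ ≡ A.𝟙
    disjointʳ : ∀ a → ¬ (a ≡ A.𝟘) → ↘ ⟨ a ] ≡ A.𝟙
    disjunctiveˡ : ∀ X Y → ↙ (X Ä.+ Y) ≡ ↙ X A.+ ↙ Y
    disjunctiveʳ : ∀ X Y → ↘ (X Ä.+ Y) ≡ ↘ X A.+ ↘ Y

Lemma4p3-Conclusion : {ℓ ℓ′ : Level} (A : KAT ℓ) → BiKATProj A ℓ′ → Set (ℓ ⊔ ℓ′)
Lemma4p3-Conclusion A P =
  ((↙ Ä.𝟙 ≡ A.𝟙) × (A.𝟙 ≡ ↘ Ä.𝟙))
  × (∀ a b → ⟨ a ] ≡ [ b ⟩ → (¬ (a ≡ A.𝟘) ⊎ ¬ (b ≡ A.𝟘)) → (a ≡ A.𝟙) × (b ≡ A.𝟙))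
  × (∀ a b → [ b ⟩ Ä.≤ ⟨ a ] → ¬ (a ≡ A.𝟘) → ¬ (b ≡ A.𝟘) → (A.𝟙 A.≤ a) × (b A.≤ A.𝟙))
  × (∀ a b → ⟨ a ] ≡ ⟨ b ] → a ≡ b)
  × (∀ a b → [ a ⟩ ≡ [ b ⟩ → a ≡ b)
  × (∀ a b → ⟨ b ] Ä.≤ ⟨ a ] → b A.≤ a)
  × (∀ a b → [ b ⟩ Ä.≤ [ a ⟩ → b A.≤ a)
  where
    open BiKATProj P
    module A = KAT A
    module Ä = KAT Ä

{-# OPTIONS --safe #-}
module Submission where

open import Defs
open import Level using (Level)
open import Relation.Binary.PropositionalEquality
open import Data.Product using (_×_; _,_)
open import Data.Sum using (_⊎_; inj₁; inj₂)
open import Relation.Nullary using (¬_)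

-- Everything follows from the projection axioms alone: inversion makes ⟨·] and [·⟩
-- split injections, disjunctivity makes the projections monotone, and disjointness
-- sends a nonzero element of the "wrong" side to 𝟙.

module _ {ℓ : Level} (K : KleeneAlgebra ℓ) where
  open KleeneAlgebra K

  nonzero⇒𝟙≢𝟘 : ∀ {a} → ¬ (a ≡ 𝟘) → ¬ (𝟙 ≡ 𝟘)
  nonzero⇒𝟙≢𝟘 {a} a≢𝟘 𝟙≡𝟘 = a≢𝟘 (begin
    a       ≡⟨ sym (︔-identityʳ a) ⟩
    a ︔ 𝟙  ≡⟨ cong (a ︔_) 𝟙≡𝟘 ⟩
    a ︔ 𝟘  ≡⟨ ︔-zeroʳ a ⟩
    𝟘       ∎)
    where open ≡-Reasoning

module _ {ℓ ℓ′ : Level} {A : KAT ℓ} (P : BiKATProj A ℓ′) where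
  open BiKATProj P
  private
    module A = KAT A
    module Ä = KAT Ä

  ↙-mono : ∀ {X Y} → X Ä.≤ Y → ↙ X A.≤ ↙ Y
  ↙-mono {X} {Y} X≤Y = trans (sym (disjunctiveˡ X Y)) (cong ↙ X≤Y)

  ↘-mono : ∀ {X Y} → X Ä.≤ Y → ↘ X A.≤ ↘ Y
  ↘-mono {X} {Y} X≤Y = trans (sym (disjunctiveʳ X Y)) (cong ↘ X≤Y)

  ↙-𝟙 : ↙ Ä.𝟙 ≡ A.𝟙
  ↙-𝟙 = trans (cong ↙ (sym (KATHom.pres-𝟙 L))) (inversionˡ A.𝟙)

  ↘-𝟙 : ↘ Ä.𝟙 ≡ A.𝟙
  ↘-𝟙 = trans (cong ↘ (sym (KATHom.pres-𝟙 R))) (inversionʳ A.𝟙)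

  ⟨]-injective : ∀ a b → ⟨ a ] ≡ ⟨ b ] → a ≡ b
  ⟨]-injective a b e = trans (sym (inversionˡ a)) (trans (cong ↙ e) (inversionˡ b))

  [⟩-injective : ∀ a b → [ a ⟩ ≡ [ b ⟩ → a ≡ b
  [⟩-injective a b e = trans (sym (inversionʳ a)) (trans (cong ↘ e) (inversionʳ b))

  ⟨]-order-reflecting : ∀ a b → ⟨ b ] Ä.≤ ⟨ a ] → b A.≤ a
  ⟨]-order-reflecting a b le =
    subst₂ A._≤_ (inversionˡ b) (inversionˡ a) (↙-mono le)

  [⟩-order-reflecting : ∀ a b → [ b ⟩ Ä.≤ [ a ⟩ → b A.≤ a
  [⟩-order-reflecting a b le =
    subst₂ A._≤_ (inversionʳ b) (inversionʳ a) (↘-mono le)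

  [⟩≤⟨]⇒𝟙≤ : ∀ {a b} → [ b ⟩ Ä.≤ ⟨ a ] → ¬ (b ≡ A.𝟘) → A.𝟙 A.≤ a
  [⟩≤⟨]⇒𝟙≤ {a} {b} le b≢𝟘 =
    subst₂ A._≤_ (disjointˡ b b≢𝟘) (inversionˡ a) (↙-mono le)

  [⟩≤⟨]⇒≤𝟙 : ∀ {a b} → [ b ⟩ Ä.≤ ⟨ a ] → ¬ (a ≡ A.𝟘) → b A.≤ A.𝟙
  [⟩≤⟨]⇒≤𝟙 {a} {b} le a≢𝟘 =
    subst₂ A._≤_ (inversionʳ b) (disjointʳ a a≢𝟘) (↘-mono le)

  order-separation : ∀ a b → [ b ⟩ Ä.≤ ⟨ a ] → ¬ (a ≡ A.𝟘) → ¬ (b ≡ A.𝟘)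
                   → (A.𝟙 A.≤ a) × (b A.≤ A.𝟙)
  order-separation a b le a≢𝟘 b≢𝟘 = [⟩≤⟨]⇒𝟙≤ le b≢𝟘 , [⟩≤⟨]⇒≤𝟙 le a≢𝟘

  ⟨]≡[⟩⇒ˡ≡𝟙 : ∀ {a b} → ⟨ a ] ≡ [ b ⟩ → ¬ (b ≡ A.𝟘) → a ≡ A.𝟙
  ⟨]≡[⟩⇒ˡ≡𝟙 {a} {b} e b≢𝟘 =
    trans (sym (inversionˡ a)) (trans (cong ↙ e) (disjointˡ b b≢𝟘))

  ⟨]≡[⟩⇒ʳ≡𝟙 : ∀ {a b} → ⟨ a ] ≡ [ b ⟩ → ¬ (a ≡ A.𝟘) → b ≡ A.𝟙
  ⟨]≡[⟩⇒ʳ≡𝟙 {a} {b} e a≢𝟘 =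
    trans (sym (inversionʳ b)) (trans (cong ↘ (sym e)) (disjointʳ a a≢𝟘))

  -- Once one side is 𝟙, the other is nonzero because 𝟙 ≢ 𝟘 in a nontrivial algebra.
  separation : ∀ a b → ⟨ a ] ≡ [ b ⟩ → (¬ (a ≡ A.𝟘) ⊎ ¬ (b ≡ A.𝟘))
             → (a ≡ A.𝟙) × (b ≡ A.𝟙)
  separation a b e (inj₁ a≢𝟘) = ⟨]≡[⟩⇒ˡ≡𝟙 e b≢𝟘 , b≡𝟙
    where
      b≡𝟙 : b ≡ A.𝟙
      b≡𝟙 = ⟨]≡[⟩⇒ʳ≡𝟙 e a≢𝟘
      b≢𝟘 : ¬ (b ≡ A.𝟘)
      b≢𝟘 b≡𝟘 = nonzero⇒𝟙≢𝟘 A.KA a≢𝟘 (trans (sym b≡𝟙) b≡𝟘)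
  separation a b e (inj₂ b≢𝟘) = a≡𝟙 , ⟨]≡[⟩⇒ʳ≡𝟙 e a≢𝟘
    where
      a≡𝟙 : a ≡ A.𝟙
      a≡𝟙 = ⟨]≡[⟩⇒ˡ≡𝟙 e b≢𝟘
      a≢𝟘 : ¬ (a ≡ A.𝟘)
      a≢𝟘 a≡𝟘 = nonzero⇒𝟙≢𝟘 A.KA b≢𝟘 (trans (sym a≡𝟙) a≡𝟘)

lemma4p3 : {ℓ ℓ′ : Level} (A : KAT ℓ) (P : BiKATProj A ℓ′) → Lemma4p3-Conclusion A P
lemma4p3 A P =
    (↙-𝟙 P , sym (↘-𝟙 P))
  , separation P
  , order-separation P
  , ⟨]-injective P
  , [⟩-injective P
  , ⟨]-order-reflecting P
  , [⟩-order-reflecting P
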